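{- If $s$ is a $+$-term and $s\lesssim_{ACh}h(t)$, then $s\lesssim_{ACh}t$.
   Context: Terms are over $\{+,h,0\}$, variables and free constants. A $+$-term is a term containing only variables, constants and $+$, with no occurrence of $h$. $ACh$ is the theory generated by associativity and commutativity of $+$ and $h(x+y)\approx h(x)+h(y)$. $s\lesssim_{ACh}t$ means there is a substitution $\sigma$ with $s\sigma=_{ACh}t$. -}

module Defs where

open import Data.Nat using (ℕ)
open import Data.Product using (∃)
open import Data.Unit using (⊤)
open import Data.Product using (_×_)
open import Data.Empty using (⊥)

infixl 6 _⊕_

data Term : Set where
  var   : ℕ → Term
  const : ℕ → Term
  𝟘     : Term
  _⊕_   : Term → Term → Term
  h     : Term → Term

Subst : Set
Subst = ℕ → Term

_[_] : Term → Subst → Term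
var x   [ σ ] = σ x
const c [ σ ] = const c
𝟘       [ σ ] = 𝟘
(s ⊕ t) [ σ ] = (s [ σ ]) ⊕ (t [ σ ])
h s     [ σ ] = h (s [ σ ])

IsPlusTerm : Term → Set
IsPlusTerm (var x)   = ⊤
IsPlusTerm (const c) = ⊤
IsPlusTerm 𝟘         = ⊥
IsPlusTerm (s ⊕ t)   = IsPlusTerm s × IsPlusTerm t
IsPlusTerm (h s)     = ⊥

-- The equational theory ACh: the least congruence (equivalence relation,
-- closed under the function symbols) containing all instances of
-- associativity and commutativity of + and h(x+y) ≈ h(x)+h(y).
-- (Closure under substitution is immediate since the axioms are stated
-- for arbitrary terms.)
infix 4 _≈ACh_
data _≈ACh_ : Term → Term → Set where
  assoc  : ∀ x y z → (x ⊕ y) ⊕ z ≈ACh x ⊕ (y ⊕ z)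
  comm   : ∀ x y → x ⊕ y ≈ACh y ⊕ x
  hdist  : ∀ x y → h (x ⊕ y) ≈ACh h x ⊕ h y
  refl   : ∀ {s} → s ≈ACh s
  sym    : ∀ {s t} → s ≈ACh t → t ≈ACh s
  trans  : ∀ {s t u} → s ≈ACh t → t ≈ACh u → s ≈ACh u
  ⊕-cong : ∀ {s s' t t'} → s ≈ACh s' → t ≈ACh t' → s ⊕ t ≈ACh s' ⊕ t'
  h-cong : ∀ {s s'} → s ≈ACh s' → h s ≈ACh h s'

infix 4 _≲ACh_
_≲ACh_ : Term → Term → Set
s ≲ACh t = ∃ λ (σ : Subst) → s [ σ ] ≈ACh t

-- Let unh erase the outermost h of each summand: it is a homomorphism for +
-- and sends h u to u. It respects ACh, because h-distribution becomes an
-- identity and the h-congruence rule becomes its own premise; and it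
-- commutes with instantiating a +-term. So from sσ ≈ h t we get
-- s(unh ∘ σ) = unh (sσ) ≈ unh (h t) = t.
module Submission where

open import Defs
open import Data.Product using (_,_)
open import Relation.Binary.PropositionalEquality using (_≡_; cong₂; subst)
  renaming (refl to ≡-refl)

unh : Term → Term
unh (var x)   = var x
unh (const c) = const c
unh 𝟘         = 𝟘
unh (a ⊕ b)   = unh a ⊕ unh b
unh (h u)     = u

unh-cong : ∀ {a b} → a ≈ACh b → unh a ≈ACh unh b
unh-cong (assoc x y z) = assoc _ _ _
unh-cong (comm x y)    = comm _ _
unh-cong (hdist x y)   = refl
unh-cong refl          = refl
unh-cong (sym p)       = sym (unh-cong p)
unh-cong (trans p q)   = trans (unh-cong p) (unh-cong q)
unh-cong (⊕-cong p q)  = ⊕-cong (unh-cong p) (unh-cong q)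
unh-cong (h-cong p)    = p

unh-[] : ∀ s (σ : Subst) → IsPlusTerm s → unh (s [ σ ]) ≡ s [ (λ x → unh (σ x)) ]
unh-[] (var x)   σ _          = ≡-refl
unh-[] (const c) σ _          = ≡-refl
unh-[] (a ⊕ b)   σ (pa , pb)  = cong₂ _⊕_ (unh-[] a σ pa) (unh-[] b σ pb)

mainTheorem13 : ∀ (s t : Term) → IsPlusTerm s → s ≲ACh h t → s ≲ACh t
mainTheorem13 s t ps (σ , sσ≈ht) =
  (λ x → unh (σ x)) , subst (_≈ACh t) (unh-[] s σ ps) (unh-cong sσ≈ht)
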